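{- For all $a,b:\mathsf{lang}_\Sigma$, $(\forall l:\mathsf{list}\,\Sigma,\ \mathsf{in\_lang}\,a\,l=\mathsf{in\_lang}\,b\,l)\iff a=b$.
   Context: $\Sigma$ is a finite alphabet. $\mathsf{lang}_\Sigma$ is the coinductive type with single constructor $\mathsf{lnode}\,b\,k$ ($b:\mathbb{B}$, $k:\Sigma\to\mathsf{lang}_\Sigma$), ordered coinductively by $\mathsf{lnode}\,b_1\,f\sqsubseteq\mathsf{lnode}\,b_2\,g$ if $b_1\sqsubseteq b_2$ ($\mathbf{false}\sqsubseteq\mathbf{true}$) and $f\,a\sqsubseteq g\,a$ for all $a$. Standing axiom: if $a\sqsubseteq b$ and $b\sqsubseteq a$ then $a=b$. $\mathsf{in\_lang}:\mathsf{lang}_\Sigma\to\mathsf{list}\,\Sigma\to\mathbb{B}$ is defined by recursion on the list: $\mathsf{in\_lang}(\mathsf{lnode}\,b\,\_)\,\mathsf{nil}=b$, $\mathsf{in\_lang}(\mathsf{lnode}\,\_\,k)(\mathsf{cons}\,a\,l)=\mathsf{in\_lang}(k\,a)\,l$. -}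

module Defs where

open import Data.Bool using (Bool; false; true) renaming (_≤_ to _≤ᵇ_)
open import Data.List using (List; []; _∷_)
open import Relation.Binary.PropositionalEquality using (_≡_)
open import Data.Product using (_×_; Σ-syntax)

record Lang (Σ : Set) : Set where
  coinductive
  constructor lnode
  field
    accepts : Bool
    next    : Σ → Lang Σ
open Lang public

-- coinductive order:  lnode b₁ f ⊑ lnode b₂ g  iff  b₁ ⊑ b₂ (false ⊑ true) and ∀ a, f a ⊑ g a.
-- Since --guardedness is unavailable, the coinductive relation is defined as its greatest fixed
-- point (Knaster–Tarski): x ⊑ y iff some simulation relation R relates x and y, where R is a
-- simulation if it is a post-fixed point of the defining rule.
IsSimulation : {Σ : Set} → (Lang Σ → Lang Σ → Set) → Set
IsSimulation {Σ} R = ∀ x y → R x y → (accepts x ≤ᵇ accepts y) × (∀ (a : Σ) → R (next x a) (next y a))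

_⊑_ : {Σ : Set} → Lang Σ → Lang Σ → Set₁
x ⊑ y = Σ-syntax _ λ R → IsSimulation R × R x y

LangAntisym : Set → Set₁
LangAntisym Σ = ∀ (a b : Lang Σ) → a ⊑ b → b ⊑ a → a ≡ b

in-lang : {Σ : Set} → Lang Σ → List Σ → Bool
in-lang x []       = accepts x
in-lang x (a ∷ l)  = in-lang (next x a) l

module Submission where

open import Defs
open import Data.Nat using (ℕ)
open import Data.Fin using (Fin)
open import Data.List using (List; []; _∷_)
open import Data.Bool.Properties using (≤-reflexive)
open import Data.Product using (_,_)
open import Function.Bundles using (_⇔_; mk⇔)
open import Relation.Binary.PropositionalEquality using (_≡_; refl; sym; cong)

-- Trace equivalence (equality of accepted languages) is itself a simulation, so language
-- equality yields ⊑ in both directions, and antisymmetry turns that into equality.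

module _ {Σ : Set} where

  _≈ˡ_ : Lang Σ → Lang Σ → Set
  x ≈ˡ y = ∀ (l : List Σ) → in-lang x l ≡ in-lang y l

  ≈ˡ-sym : ∀ {x y} → x ≈ˡ y → y ≈ˡ x
  ≈ˡ-sym x≈y l = sym (x≈y l)

  ≈ˡ-isSimulation : IsSimulation _≈ˡ_
  ≈ˡ-isSimulation x y x≈y = ≤-reflexive (x≈y []) , λ a l → x≈y (a ∷ l)

  ≈ˡ⇒⊑ : ∀ {x y} → x ≈ˡ y → x ⊑ y
  ≈ˡ⇒⊑ x≈y = _≈ˡ_ , ≈ˡ-isSimulation , x≈y

  ≈ˡ⇒≡ : LangAntisym Σ → ∀ {x y} → x ≈ˡ y → x ≡ y
  ≈ˡ⇒≡ antisym {x} {y} x≈y = antisym x y (≈ˡ⇒⊑ x≈y) (≈ˡ⇒⊑ (≈ˡ-sym x≈y))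

  ≡⇒≈ˡ : ∀ {x y} → x ≡ y → x ≈ˡ y
  ≡⇒≈ˡ x≡y l = cong (λ z → in-lang z l) x≡y

mainTheorem6 : (n : ℕ) → LangAntisym (Fin n) → (a b : Lang (Fin n))
    → (∀ (l : List (Fin n)) → in-lang a l ≡ in-lang b l) ⇔ (a ≡ b)
mainTheorem6 n antisym a b = mk⇔ (≈ˡ⇒≡ antisym) ≡⇒≈ˡ
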